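{- Let $n$ be a positive integer. If $2n$ is matchable, then $n$ is matchable.
   Context: For a positive integer $n$, let $D(n)$ be its set of positive divisors and $\tau(n)=|D(n)|$. A coprime matching between two finite sets of integers of the same cardinality is a bijection $\psi$ between them such that $\gcd(x,\psi(x))=1$ for every $x$ in the domain. A positive integer $n$ is called matchable if there is a coprime matching between $\{1,2,\dots,\tau(n)\}$ and $D(n)$. -}

module Defs where

open import Data.Nat using (ℕ; suc; _*_)
open import Data.Nat.Divisibility using (_∣?_)
open import Data.Nat.Coprimality using (Coprime)
open import Data.List using (List; filter; length; upTo; map; lookup)
open import Data.Fin using (Fin; toℕ)
open import Data.Product using (Σ)
open import Function.Bundles using (_⤖_; Bijection)

divisors : ℕ → List ℕ
divisors n = filter (_∣? n) (map suc (upTo n))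

τ : ℕ → ℕ
τ n = length (divisors n)

divisorAt : (n : ℕ) → Fin (τ n) → ℕ
divisorAt n i = lookup (divisors n) i

-- n is matchable: there is a bijection ψ from {1,…,τ(n)} to D(n) with
-- gcd(x, ψ(x)) = 1.  Position i : Fin (τ n) stands for x = i + 1, and a
-- bijection onto D(n) is given as a bijection onto the indices of the
-- (repetition-free) divisor list.
Matchable : ℕ → Set
Matchable n =
  Σ (Fin (τ n) ⤖ Fin (τ n)) λ ψ →
    ∀ (i : Fin (τ n)) → Coprime (suc (toℕ i)) (divisorAt n (Bijection.to ψ i))

-- In a coprime matching ψ for 2n, the even numbers x = 2(j+1) ≤ τ(2n) must be
-- matched with odd divisors of 2n, i.e. with odd divisors of n, and ψ(2(j+1))
-- is coprime to j + 1.  The odd divisors e of n together with their doubles 2e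
-- are distinct divisors of 2n, so τ(2n) ≥ 2τ(n); if n is odd, the first τ(n)
-- even positions therefore give a coprime matching j + 1 ↦ ψ(2(j+1)) for n.
-- If n is even and n ≠ 2, the ⌊τ(2n)/2⌋ odd partners, their doubles, and the
-- divisors 4 and 2n (both ≡ 0 mod 4) give τ(2n) ≥ 2⌊τ(2n)/2⌋ + 2, which is
-- impossible; and 2 is matchable.
module Submission where

open import Defs
open import Data.Nat using (ℕ; _*_; _≤_)
open import Data.Nat.Base using (zero; suc; _+_; _<_; s≤s; z≤n; NonZero; ≢-nonZero⁻¹; ⌊_/2⌋)
open import Data.Nat.Properties
  using (_≟_; suc-injective; +-identityʳ; *-suc; *-cancelˡ-≡; *-monoʳ-≤; ≤-trans; 1+n≰n; <⇒≱; m*n≢0)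
open import Data.Nat.Divisibility
open import Data.Nat.Coprimality using (Coprime; coprime-divisor; 1-coprimeTo)
  renaming (sym to coprime-sym)
open import Data.List.Base using (List; lookup; upTo)
import Data.List.Base as List
open import Data.List.Relation.Unary.Unique.Propositional using (Unique)
import Data.List.Relation.Unary.Unique.Propositional.Properties as Unique
import Data.List.Relation.Unary.AllPairs as AllPairs
import Data.List.Relation.Unary.All as ListAll
open import Data.List.Membership.Propositional using (_∈_)
open import Data.List.Membership.Propositional.Properties
  using (∈-filter⁺; ∈-filter⁻; ∈-map⁺; ∈-upTo⁺; ∈-lookup)
open import Data.List.Relation.Unary.Any using (index)
open import Data.List.Relation.Unary.Any.Properties using (lookup-index)
open import Data.Fin.Base as Fin using (Fin; toℕ; fromℕ<; splitAt; _↑ˡ_; _↑ʳ_; punchOut)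
open import Data.Fin.Properties
  using (toℕ<n; toℕ-fromℕ<; toℕ-injective; fromℕ<-injective; splitAt⁻¹-↑ˡ; splitAt⁻¹-↑ʳ;
         any?; injective⇒≤; punchOut-injective)
  renaming (_≟_ to _≟ᶠ_)
open import Data.Fin.Patterns using (0F; 1F)
open import Data.Fin.Permutation using (reverse)
open import Data.Vec.Functional using (Vector; []; _∷_; _++_; map)
open import Data.Vec.Functional.Relation.Unary.All using (All)
open import Data.Vec.Functional.Relation.Unary.All.Properties using (++⁺)
open import Data.Product using (_×_; _,_; proj₁; proj₂)
open import Data.Sum using (inj₁; inj₂)
open import Function.Bundles using (_⤖_; Bijection; mk⤖)
open import Function.Definitions using (Injective; StrictlySurjective)
open import Function.Consequences.Propositional using (strictlySurjective⇒surjective)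
open import Function.Properties.Inverse using (↔⇒⤖)
open import Relation.Nullary using (¬_; yes; no; contradiction)
open import Relation.Unary using (Pred; ∁)
open import Relation.Binary.PropositionalEquality
open ≡-Reasoning

injective⇒strictlySurjective : ∀ {n} {f : Fin n → Fin n} →
                               Injective _≡_ _≡_ f → StrictlySurjective _≡_ f
injective⇒strictlySurjective {suc n} {f} f-injective y with any? (λ x → f x ≟ᶠ y)
... | yes hit = hit
... | no miss = contradiction (injective⇒≤ {f = f′} f′-injective) 1+n≰n
  where
  y≢f : ∀ x → y ≢ f x
  y≢f x y≡fx = miss (x , sym y≡fx)

  f′ : Fin (suc n) → Fin n
  f′ x = punchOut (y≢f x)

  f′-injective : Injective _≡_ _≡_ f′
  f′-injective {x} {x′} eq = f-injective (punchOut-injective (y≢f x) (y≢f x′) eq)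

injective⇒⤖ : ∀ {n} {f : Fin n → Fin n} → Injective _≡_ _≡_ f → Fin n ⤖ Fin n
injective⇒⤖ f-injective =
  mk⤖ (f-injective , strictlySurjective⇒surjective (injective⇒strictlySurjective f-injective))

++-injective : ∀ {a p} {A : Set a} {m n} (P : Pred A p) {xs : Vector A m} {ys : Vector A n} →
               Injective _≡_ _≡_ xs → Injective _≡_ _≡_ ys → All P xs → All (∁ P) ys →
               Injective _≡_ _≡_ (xs ++ ys)
++-injective {m = m} P xs-injective ys-injective Pxs ¬Pys {i} {j} eq
  with splitAt m i in i≡ | splitAt m j in j≡
... | inj₁ k | inj₁ l =
  trans (sym (splitAt⁻¹-↑ˡ i≡)) (trans (cong (_↑ˡ _) (xs-injective eq)) (splitAt⁻¹-↑ˡ j≡))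
... | inj₂ k | inj₂ l =
  trans (sym (splitAt⁻¹-↑ʳ i≡)) (trans (cong (m ↑ʳ_) (ys-injective eq)) (splitAt⁻¹-↑ʳ j≡))
... | inj₁ k | inj₂ l = contradiction (subst P eq (Pxs k)) (¬Pys l)
... | inj₂ k | inj₁ l = contradiction (subst P (sym eq) (Pxs l)) (¬Pys k)

lookup-injective : ∀ {a} {A : Set a} {xs : List A} → Unique xs → Injective _≡_ _≡_ (lookup xs)
lookup-injective (_  AllPairs.∷ _) {0F}        {0F}        _  = refl
lookup-injective (x∉ AllPairs.∷ _) {0F}        {Fin.suc j} eq =
  contradiction eq (ListAll.lookup x∉ (∈-lookup j))
lookup-injective (x∉ AllPairs.∷ _) {Fin.suc i} {0F}        eq =
  contradiction (sym eq) (ListAll.lookup x∉ (∈-lookup i))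
lookup-injective (_  AllPairs.∷ u) {Fin.suc i} {Fin.suc j} eq = cong Fin.suc (lookup-injective u eq)

2*⌊n/2⌋≤n : ∀ n → 2 * ⌊ n /2⌋ ≤ n
2*⌊n/2⌋≤n 0             = z≤n
2*⌊n/2⌋≤n 1             = z≤n
2*⌊n/2⌋≤n (suc (suc n)) =
  subst (_≤ 2 + n) (sym (*-suc 2 ⌊ n /2⌋)) (s≤s (s≤s (2*⌊n/2⌋≤n n)))

n<2+2*⌊n/2⌋ : ∀ n → n < 2 + 2 * ⌊ n /2⌋
n<2+2*⌊n/2⌋ 0             = s≤s z≤n
n<2+2*⌊n/2⌋ 1             = s≤s (s≤s z≤n)
n<2+2*⌊n/2⌋ (suc (suc n)) =
  subst (2 + n <_) (cong (2 +_) (sym (*-suc 2 ⌊ n /2⌋))) (s≤s (s≤s (n<2+2*⌊n/2⌋ n)))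

coprime-∣ˡ : ∀ {d m n} → d ∣ m → Coprime m n → Coprime d n
coprime-∣ˡ d∣m coprime (i∣d , i∣n) = coprime (∣-trans i∣d d∣m , i∣n)

divisors-unique : ∀ n → Unique (divisors n)
divisors-unique n = Unique.filter⁺ (_∣? n) (Unique.map⁺ suc-injective (Unique.upTo⁺ n))

divisorAt-injective : ∀ n → Injective _≡_ _≡_ (divisorAt n)
divisorAt-injective n = lookup-injective (divisors-unique n)

divisorAt-∣ : ∀ n i → divisorAt n i ∣ n
divisorAt-∣ n i = proj₂ (∈-filter⁻ (_∣? n) {xs = List.map suc (upTo n)} (∈-lookup i))

∣⇒∈divisors : ∀ {n d} .{{_ : NonZero n}} → d ∣ n → d ∈ divisors n
∣⇒∈divisors {n} {zero}  0∣n = contradiction (0∣⇒≡0 0∣n) (≢-nonZero⁻¹ n)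
∣⇒∈divisors {n} {suc d} d∣n = ∈-filter⁺ (_∣? n) (∈-map⁺ suc (∈-upTo⁺ (∣⇒≤ d∣n))) d∣n

divisorIndex : ∀ n .{{_ : NonZero n}} {d} → d ∣ n → Fin (τ n)
divisorIndex n d∣n = index (∣⇒∈divisors d∣n)

divisorAt-divisorIndex : ∀ n .{{_ : NonZero n}} {d} (d∣n : d ∣ n) →
                         divisorAt n (divisorIndex n d∣n) ≡ d
divisorAt-divisorIndex n d∣n = sym (lookup-index (∣⇒∈divisors d∣n))

divisorIndex-injective : ∀ n .{{_ : NonZero n}} {d e} (d∣n : d ∣ n) (e∣n : e ∣ n) →
                         divisorIndex n d∣n ≡ divisorIndex n e∣n → d ≡ e
divisorIndex-injective n {d} {e} d∣n e∣n eq = begin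
  d                                ≡⟨ divisorAt-divisorIndex n d∣n ⟨
  divisorAt n (divisorIndex n d∣n) ≡⟨ cong (divisorAt n) eq ⟩
  divisorAt n (divisorIndex n e∣n) ≡⟨ divisorAt-divisorIndex n e∣n ⟩
  e                                ∎

injective-divisors⇒≤τ : ∀ n .{{_ : NonZero n}} {k} {ds : Vector ℕ k} →
                        Injective _≡_ _≡_ ds → All (_∣ n) ds → k ≤ τ n
injective-divisors⇒≤τ n ds-injective ds∣n = injective⇒≤ {f = position} position-injective
  where
  position : Fin _ → Fin (τ n)
  position i = divisorIndex n (ds∣n i)

  position-injective : Injective _≡_ _≡_ position
  position-injective {i} {j} eq = ds-injective (divisorIndex-injective n (ds∣n i) (ds∣n j) eq)

τ[2*n]-lowerBound : ∀ n .{{_ : NonZero n}} {k q} {cs : Vector ℕ k} {es : Vector ℕ q} →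
                    Injective _≡_ _≡_ cs → All (λ c → 4 ∣ c × c ∣ 2 * n) cs →
                    Injective _≡_ _≡_ es → All (λ e → ¬ 2 ∣ e × e ∣ n) es →
                    k + 2 * q ≤ τ (2 * n)
τ[2*n]-lowerBound n {k} {q} {cs} {es} cs-injective cs-props es-injective es-props =
  subst (λ m → k + m ≤ τ (2 * n)) (cong (q +_) (sym (+-identityʳ q)))
    (injective-divisors⇒≤τ (2 * n) {{m*n≢0 2 n}}
      (++-injective (4 ∣_) cs-injective doubles++es-injective
                    (λ i → proj₁ (cs-props i)) doubles++es-¬4∣)
      (++⁺ (_∣ 2 * n) (λ i → proj₂ (cs-props i)) doubles++es-∣2n))
  where
  doubles++es : Vector ℕ (q + q)
  doubles++es = map (2 *_) es ++ es

  doubles++es-injective : Injective _≡_ _≡_ doubles++es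
  doubles++es-injective =
    ++-injective (2 ∣_) (λ eq → es-injective (*-cancelˡ-≡ _ _ 2 eq)) es-injective
                 (λ i → m∣m*n (es i)) (λ i → proj₁ (es-props i))

  doubles++es-¬4∣ : All (∁ (4 ∣_)) doubles++es
  doubles++es-¬4∣ = ++⁺ (∁ (4 ∣_)) (λ i 4∣2e → proj₁ (es-props i) (*-cancelˡ-∣ 2 4∣2e))
                                   (λ i 4∣e → proj₁ (es-props i) (∣-trans (divides 2 refl) 4∣e))

  doubles++es-∣2n : All (_∣ 2 * n) doubles++es
  doubles++es-∣2n = ++⁺ (_∣ 2 * n) (λ i → *-monoʳ-∣ 2 (proj₂ (es-props i)))
                                   (λ i → ∣-trans (proj₂ (es-props i)) (n∣m*n 2))

module EvenPositions (n : ℕ) (matching : Matchable (2 * n)) (q : ℕ) (2q≤τ : 2 * q ≤ τ (2 * n)) where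

  open Bijection (proj₁ matching) using (to; injective)

  evenPosition : Fin q → Fin (τ (2 * n))
  evenPosition j =
    fromℕ< (subst (_≤ τ (2 * n)) (*-suc 2 (toℕ j)) (≤-trans (*-monoʳ-≤ 2 (toℕ<n j)) 2q≤τ))

  partner : Fin q → ℕ
  partner j = divisorAt (2 * n) (to (evenPosition j))

  partner-coprime : ∀ j → Coprime (2 * suc (toℕ j)) (partner j)
  partner-coprime j = subst (λ x → Coprime x (partner j)) x≡2[j+1] (proj₂ matching (evenPosition j))
    where
    x≡2[j+1] : suc (toℕ (evenPosition j)) ≡ 2 * suc (toℕ j)
    x≡2[j+1] = trans (cong suc (toℕ-fromℕ< _)) (sym (*-suc 2 (toℕ j)))

  partner-coprime-suc : ∀ j → Coprime (suc (toℕ j)) (partner j)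
  partner-coprime-suc j = coprime-∣ˡ (n∣m*n 2 {suc (toℕ j)}) (partner-coprime j)

  partner-odd : ∀ j → ¬ 2 ∣ partner j
  partner-odd j 2∣partner with () ← partner-coprime j (m∣m*n (suc (toℕ j)) , 2∣partner)

  partner-∣ : ∀ j → partner j ∣ n
  partner-∣ j = coprime-divisor {n = 2} {o = n} (coprime-sym coprime-2) (divisorAt-∣ (2 * n) _)
    where
    coprime-2 : Coprime 2 (partner j)
    coprime-2 = coprime-∣ˡ (m∣m*n (suc (toℕ j))) (partner-coprime j)

  partner-injective : Injective _≡_ _≡_ partner
  partner-injective {i} {j} eq =
    toℕ-injective (*-cancelˡ-≡ _ _ 2 (suc-injective (fromℕ<-injective _ _ _ _
      (injective (divisorAt-injective (2 * n) eq)))))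

odd⇒2*τ≤τ[2*n] : ∀ n .{{_ : NonZero n}} → ¬ 2 ∣ n → 2 * τ n ≤ τ (2 * n)
odd⇒2*τ≤τ[2*n] n n-odd =
  τ[2*n]-lowerBound n {cs = []} (λ { {()} }) (λ ()) (divisorAt-injective n) divisors-odd
  where
  divisors-odd : All (λ d → ¬ 2 ∣ d × d ∣ n) (divisorAt n)
  divisors-odd i = (λ 2∣d → n-odd (∣-trans 2∣d (divisorAt-∣ n i))) , divisorAt-∣ n i

odd-matchable : ∀ n .{{_ : NonZero n}} → ¬ 2 ∣ n → Matchable (2 * n) → Matchable n
odd-matchable n n-odd matching = injective⇒⤖ φ-injective , φ-coprime
  where
  open EvenPositions n matching (τ n) (odd⇒2*τ≤τ[2*n] n n-odd)

  φ : Fin (τ n) → Fin (τ n)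
  φ j = divisorIndex n (partner-∣ j)

  φ-injective : Injective _≡_ _≡_ φ
  φ-injective {i} {j} eq =
    partner-injective (divisorIndex-injective n (partner-∣ i) (partner-∣ j) eq)

  φ-coprime : ∀ j → Coprime (suc (toℕ j)) (divisorAt n (φ j))
  φ-coprime j =
    subst (Coprime _) (sym (divisorAt-divisorIndex n (partner-∣ j))) (partner-coprime-suc j)

even-unmatchable : ∀ n .{{_ : NonZero n}} → 2 ∣ n → n ≢ 2 → ¬ Matchable (2 * n)
even-unmatchable n n-even n≢2 matching =
  <⇒≱ (n<2+2*⌊n/2⌋ (τ (2 * n)))
      (τ[2*n]-lowerBound n cs-injective cs-props partner-injective (λ j → partner-odd j , partner-∣ j))
  where
  open EvenPositions n matching ⌊ τ (2 * n) /2⌋ (2*⌊n/2⌋≤n (τ (2 * n)))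

  cs : Vector ℕ 2
  cs = 4 ∷ 2 * n ∷ []

  4≢2n : 4 ≢ 2 * n
  4≢2n 4≡2n = n≢2 (sym (*-cancelˡ-≡ 2 n 2 4≡2n))

  cs-injective : Injective _≡_ _≡_ cs
  cs-injective {0F} {0F} _  = refl
  cs-injective {0F} {1F} eq = contradiction eq 4≢2n
  cs-injective {1F} {0F} eq = contradiction (sym eq) 4≢2n
  cs-injective {1F} {1F} _  = refl

  cs-props : All (λ c → 4 ∣ c × c ∣ 2 * n) cs
  cs-props 0F = ∣-refl , *-monoʳ-∣ 2 n-even
  cs-props 1F = *-monoʳ-∣ 2 n-even , ∣-refl

matchable-2 : Matchable 2
matchable-2 = ↔⇒⤖ reverse , coprime
  where
  coprime : ∀ i → Coprime (suc (toℕ i)) (divisorAt 2 (Fin.opposite i))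
  coprime 0F = 1-coprimeTo 2
  coprime 1F = coprime-sym (1-coprimeTo 2)

lemma3p1 : (n : ℕ) → 1 ≤ n → Matchable (2 * n) → Matchable n
lemma3p1 zero () _
lemma3p1 n@(suc _) _ matching with 2 ∣? n | n ≟ 2
... | no n-odd   | _        = odd-matchable n n-odd matching
... | yes _      | yes refl = matchable-2
... | yes n-even | no n≢2   = contradiction matching (even-unmatchable n n-even n≢2)
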